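{- The number of iterations (of the main while loop of the algorithm ConnectSBG described in the context) required to find all connected components is at most $2\log_2(N)$, where $N$ is the number of edges in the largest connected component.
   Context: Let $G=(V,E)$ be an undirected graph (possibly given as a Set--Based Graph, i.e. with vertices grouped into disjoint set--vertices and edges grouped into set--edges, $V$ being the union of all set--vertices and $E$ the union of all set--edges). There is a total ordering on the individual vertices. Each edge $e\in E$ has two endpoints given by two maps $E_{map}^1:E\to V$ (left endpoint) and $E_{map}^2:E\to V$ (right endpoint). Connected components are represented by a map $R_{map}:V\to V$, where $R_{map}(v)$ is the representative of the component containing $v$ (ultimately the smallest vertex of that component), with $R_{map}(v)\le v$. Algorithm ConnectSBG: initialize $R_{map}\gets$ identity on $V$ and $I_{old}\gets\emptyset$. While $I_{old}\neq \mathrm{Image}(R_{map})$ do: (1) $ER_{map}^1\gets R_{map}\circ E_{map}^1$ and $ER_{map}^2\gets R_{map}\circ E_{map}^2$ (maps from edges to the current representatives of their endpoints); (2) $\tilde R_{map}^1\gets \mathrm{minAdjMap}(ER_{map}^1,ER_{map}^2)$ and $\tilde R_{map}^2\gets \mathrm{minAdjMap}(ER_{map}^2,ER_{map}^1)$, where $\mathrm{minAdjMap}(m_1,m_2)$ is the map $m_3$ with $m_3(v)=\min\{m_2(e): m_1(e)=v\}$ (the least representative adjacent to the component represented by $v$); (3) $\tilde R_{map}\gets\min(R_{map},\tilde R_{map}^1,\tilde R_{map}^2)$ pointwise; (4) $I_{old}\gets \mathrm{Image}(R_{map})$; (5) $R_{map}\gets(\tilde R_{map})^{\infty}$, i.e.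 the result of composing $\tilde R_{map}$ with itself until a fixed point is reached. Return $R_{map}$. -}

module Defs where

open import Data.Nat as ℕ using (ℕ; zero; suc; _≤ᵇ_)
open import Data.Fin using (Fin; toℕ; _≤_)
open import Data.Fin.Subset using (Subset; _∈_; ∣_∣)
open import Data.List using (List; foldr; allFin)
open import Data.Maybe using (Maybe; just; nothing)
open import Data.Bool using (if_then_else_)
open import Data.Product using (Σ; _×_; ∃; ∃-syntax; _,_)
open import Data.Sum using (_⊎_)
open import Function using (_∘_; id; _⇔_)
open import Relation.Binary.PropositionalEquality using (_≡_)
open import Relation.Nullary using (does)
open import Relation.Binary.Construct.Closure.ReflexiveTransitive using (Star)
import Data.Fin.Properties as FinP

-- A graph: n vertices (Fin n, totally ordered by the order of Fin),
-- m edges (Fin m), with left / right endpoint maps E₁ E₂ : Fin m → Fin n.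

minV : ∀ {n} → Fin n → Fin n → Fin n
minV a b = if toℕ a ≤ᵇ toℕ b then a else b

minMV : ∀ {n} → Maybe (Fin n) → Fin n → Fin n
minMV nothing  b = b
minMV (just a) b = minV a b

minAdjMap : ∀ {n m} → (Fin m → Fin n) → (Fin m → Fin n) → Fin n → Maybe (Fin n)
minAdjMap {n} {m} m₁ m₂ v =
  foldr (λ e acc → if does (m₁ e FinP.≟ v)
                        then just (minMV acc (m₂ e))
                        else acc)
           nothing (allFin m)

-- one pass of steps (1)-(3):  R̃ = min(R, R̃¹, R̃²) pointwise
stepMap : ∀ {n m} → (Fin m → Fin n) → (Fin m → Fin n) → (Fin n → Fin n) → (Fin n → Fin n)
stepMap E₁ E₂ R v =
  let ER₁ = R ∘ E₁
      ER₂ = R ∘ E₂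
  in minMV (minAdjMap ER₂ ER₁ v) (minMV (minAdjMap ER₁ ER₂ v) (R v))

iter : ∀ {n} → ℕ → (Fin n → Fin n) → (Fin n → Fin n)
iter zero    f = id
iter (suc k) f = f ∘ iter k f

-- f^∞ : composing f with itself until a fixed point is reached.
-- For the maps arising here (f v ≤ v), f^n (n = number of vertices) is that fixed point.
closure : ∀ {n} → (Fin n → Fin n) → (Fin n → Fin n)
closure {n} f = iter n f

-- R_k : the representative map after k iterations of the while loop
Rmap : ∀ {n m} → (Fin m → Fin n) → (Fin m → Fin n) → ℕ → (Fin n → Fin n)
Rmap E₁ E₂ zero    = id
Rmap E₁ E₂ (suc k) = closure (stepMap E₁ E₂ (Rmap E₁ E₂ k))

Adjacent : ∀ {n m} → (Fin m → Fin n) → (Fin m → Fin n) → Fin n → Fin n → Set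
Adjacent E₁ E₂ u v = ∃[ e ] ((E₁ e ≡ u × E₂ e ≡ v) ⊎ (E₁ e ≡ v × E₂ e ≡ u))

Connected : ∀ {n m} → (Fin m → Fin n) → (Fin m → Fin n) → Fin n → Fin n → Set
Connected E₁ E₂ = Star (Adjacent E₁ E₂)

IsComponentMap : ∀ {n m} → (Fin m → Fin n) → (Fin m → Fin n) → (Fin n → Fin n) → Set
IsComponentMap E₁ E₂ R =
  ∀ v → Connected E₁ E₂ v (R v) × (∀ w → Connected E₁ E₂ v w → R v ≤ w)

ComponentEdges : ∀ {n m} → (Fin m → Fin n) → (Fin m → Fin n) → Fin n → Subset m → Set
ComponentEdges E₁ E₂ v S = ∀ e → (e ∈ S) ⇔ Connected E₁ E₂ v (E₁ e)

LargestComponentEdges : ∀ {n m} → (Fin m → Fin n) → (Fin m → Fin n) → ℕ → Set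
LargestComponentEdges E₁ E₂ N =
  (∀ v S → ComponentEdges E₁ E₂ v S → ∣ S ∣ ℕ.≤ N)
  × (∃[ v ] ∃[ S ] (ComponentEdges E₁ E₂ v S × ∣ S ∣ ≡ N))

-- Fix a component and count its representatives at round k, the vertices r of the component
-- with R k r ≡ r. If r survives until round k + 2, then every class adjacent to r's class at
-- round k has merged into r by then: for an edge u – w leaving the class,
-- r ≤ R (k + 1) w ≤ R k u ≡ r. Hence, while the component still holds two representatives,
-- every survivor of round k + 2 absorbs a representative of round k that does not survive,
-- and the count at least halves every two rounds. The count starts at no more than N + 1
-- (every vertex but one is the farther end of an edge to a vertex closer to the root), and
-- the first round removes at least one representative. So with 2 ^ a ≤ N < 2 ^ (a + 1) the
-- component is resolved after 2a rounds, or after 2a + 1 rounds when N + 1 ≡ 2 ^ (a + 1).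
module Submission where

open import Defs
open import Level using (0ℓ)
open import Data.Nat as ℕ using (ℕ; zero; suc; _+_; _*_; _^_; _≤_; _<_; z≤n; s≤s)
import Data.Nat.Properties as ℕₚ
open import Data.Nat.Tactic.RingSolver using (solve-∀)
open import Data.Fin as Fin using (Fin; zero; suc; toℕ)
import Data.Fin.Properties as Finₚ
open import Data.Fin.Subset using (_∈_; ∣_∣)
open import Data.Vec using (tabulate)
import Data.Vec.Properties as Vecₚ
open import Data.Bool using (true; false; T; if_then_else_)
open import Data.Maybe using (Maybe; just; nothing)
open import Data.List using (List; []; _∷_; foldr; allFin)
import Data.List.Membership.Propositional as List
open import Data.List.Membership.Propositional.Properties using (∈-allFin)
open import Data.List.Relation.Unary.Any using (here; there)
open import Data.Product using (_×_; _,_; proj₁; proj₂; ∃-syntax; ∃₂)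
open import Data.Sum using (_⊎_; inj₁; inj₂)
open import Data.Empty using (⊥-elim)
open import Function using (_∘_; _⇔_; mk⇔; case_of_)
open import Relation.Binary using (Rel; tri<; tri≈; tri>)
open import Relation.Binary.PropositionalEquality
open import Relation.Nullary using (¬_; Dec; yes; no; does)
open import Relation.Nullary.Decidable using (_×-dec_; _⊎-dec_; dec-true; dec-false; ¬¬-excluded-middle)
open import Relation.Unary using (Pred; Decidable; _⊆_; _∩_; ∁; U)
open import Relation.Unary.Properties using (_∩?_; ∁?; U?)
open import Relation.Binary.Construct.Closure.ReflexiveTransitive using (Star; ε; _◅_; _◅◅_; reverse)

count : ∀ {n} {P : Pred (Fin n) 0ℓ} → Decidable P → ℕ
count {zero}  P? = 0
count {suc n} P? = (if does (P? zero) then 1 else 0) + count (P? ∘ suc)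

count-empty : ∀ {n} {P : Pred (Fin n) 0ℓ} (P? : Decidable P) → (∀ x → ¬ P x) → count P? ≡ 0
count-empty {zero}  P? none = refl
count-empty {suc n} P? none with P? zero
... | yes p = ⊥-elim (none zero p)
... | no _  = count-empty (P? ∘ suc) (none ∘ suc)

count-mono : ∀ {n} {P Q : Pred (Fin n) 0ℓ} (P? : Decidable P) (Q? : Decidable Q) →
             P ⊆ Q → count P? ≤ count Q?
count-mono {zero}  P? Q? P⊆Q = z≤n
count-mono {suc n} P? Q? P⊆Q with P? zero | Q? zero
... | yes p | no ¬q = ⊥-elim (¬q (P⊆Q p))
... | yes _ | yes _ = s≤s (count-mono (P? ∘ suc) (Q? ∘ suc) P⊆Q)
... | no _  | yes _ = ℕₚ.m≤n⇒m≤1+n (count-mono (P? ∘ suc) (Q? ∘ suc) P⊆Q)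
... | no _  | no _  = count-mono (P? ∘ suc) (Q? ∘ suc) P⊆Q

count-partition : ∀ {n} {P Q : Pred (Fin n) 0ℓ} (P? : Decidable P) (Q? : Decidable Q) →
                  count P? ≡ count (P? ∩? Q?) + count (P? ∩? ∁? Q?)
count-partition {zero}  P? Q? = refl
count-partition {suc n} P? Q? with P? zero | Q? zero
... | yes _ | yes _ = cong suc (count-partition (P? ∘ suc) (Q? ∘ suc))
... | yes _ | no _  = trans (cong suc (count-partition (P? ∘ suc) (Q? ∘ suc))) (sym (ℕₚ.+-suc _ _))
... | no _  | _     = count-partition (P? ∘ suc) (Q? ∘ suc)

count-subsingleton : ∀ {n} {P : Pred (Fin n) 0ℓ} (P? : Decidable P) →
                     (∀ {x y} → P x → P y → x ≡ y) → count P? ≤ 1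
count-subsingleton {zero}  P? unique = z≤n
count-subsingleton {suc n} P? unique with P? zero
... | yes p₀ = s≤s (ℕₚ.≤-reflexive (count-empty (P? ∘ suc) λ x p → case unique p₀ p of λ ()))
... | no _   = count-subsingleton (P? ∘ suc) λ p q → Finₚ.suc-injective (unique p q)

count-remove : ∀ {n} {P : Pred (Fin n) 0ℓ} (P? : Decidable P) (a : Fin n) →
               count P? ≤ suc (count (P? ∩? ∁? (Finₚ._≟ a)))
count-remove P? a = ℕₚ.≤-trans (ℕₚ.≤-reflexive (count-partition P? (Finₚ._≟ a)))
  (ℕₚ.+-monoˡ-≤ _ (count-subsingleton (P? ∩? (Finₚ._≟ a)) λ (_ , x≡a) (_ , y≡a) →
                      trans x≡a (sym y≡a)))

count-surjection : ∀ {n n′} {P : Pred (Fin n) 0ℓ} {Q : Pred (Fin n′) 0ℓ}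
                   (P? : Decidable P) (Q? : Decidable Q) (g : Fin n′ → Fin n) →
                   (∀ {x} → P x → ∃[ y ] (Q y × g y ≡ x)) → count P? ≤ count Q?
count-surjection {n′ = zero} P? Q? g onto =
  ℕₚ.≤-reflexive (count-empty P? λ x p → case proj₁ (onto p) of λ ())
count-surjection {n′ = suc n′} {P} {Q} P? Q? g onto with Q? zero
... | no ¬q₀ = count-surjection P? (Q? ∘ suc) (g ∘ suc) onto′
  where
  onto′ : ∀ {x} → P x → ∃[ y ] (Q (suc y) × g (suc y) ≡ x)
  onto′ p with onto p
  ... | zero  , q₀ , _   = ⊥-elim (¬q₀ q₀)
  ... | suc y , q  , gy≡x = y , q , gy≡x
... | yes _ = ℕₚ.≤-trans (count-remove P? (g zero))
                (s≤s (count-surjection (P? ∩? ∁? (Finₚ._≟ g zero)) (Q? ∘ suc) (g ∘ suc) onto′))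
  where
  onto′ : ∀ {x} → (P ∩ ∁ (_≡ g zero)) x → ∃[ y ] (Q (suc y) × g (suc y) ≡ x)
  onto′ (p , x≢g₀) with onto p
  ... | zero  , _ , g₀≡x = ⊥-elim (x≢g₀ (sym g₀≡x))
  ... | suc y , q , gy≡x = y , q , gy≡x

count-≥1 : ∀ {n} {P : Pred (Fin n) 0ℓ} (P? : Decidable P) {a} → P a → 1 ≤ count P?
count-≥1 P? {a} Pa = count-surjection (U? {A = Fin 1}) P? (λ _ → zero) λ { {zero} _ → a , Pa , refl }

count-≥2 : ∀ {n} {P : Pred (Fin n) 0ℓ} (P? : Decidable P) →
           (∃₂ λ a b → a ≢ b × P a × P b) → 2 ≤ count P?
count-≥2 {n} {P} P? (a , b , a≢b , Pa , Pb) = count-surjection (U? {A = Fin 2}) P? side onto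
  where
  side : Fin n → Fin 2
  side x = if does (x Finₚ.≟ a) then zero else suc zero
  onto : ∀ {i} → U i → ∃[ x ] (P x × side x ≡ i)
  onto {zero}     _ = a , Pa , cong (if_then zero else suc zero) (dec-true (a Finₚ.≟ a) refl)
  onto {suc zero} _ = b , Pb , cong (if_then zero else suc zero) (dec-false (b Finₚ.≟ a) (a≢b ∘ sym))

∣tabulate∣≡count : ∀ {n} {P : Pred (Fin n) 0ℓ} (P? : Decidable P) →
                   ∣ tabulate (does ∘ P?) ∣ ≡ count P?
∣tabulate∣≡count {zero}  P? = refl
∣tabulate∣≡count {suc n} P? with P? zero
... | yes _ = cong suc (∣tabulate∣≡count (P? ∘ suc))
... | no _  = ∣tabulate∣≡count (P? ∘ suc)

dec-true⁻¹ : ∀ {A : Set} (a? : Dec A) → does a? ≡ true → A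
dec-true⁻¹ (yes a) _ = a

∈-tabulate⇔ : ∀ {n} {P : Pred (Fin n) 0ℓ} (P? : Decidable P) x → x ∈ tabulate (does ∘ P?) ⇔ P x
∈-tabulate⇔ P? x = mk⇔
  (λ x∈ → dec-true⁻¹ (P? x) (trans (sym (Vecₚ.lookup∘tabulate _ x)) (Vecₚ.[]=⇒lookup x∈)))
  (λ Px → Vecₚ.lookup⇒[]= x _ (trans (Vecₚ.lookup∘tabulate _ x) (dec-true (P? x) Px)))

¬¬-decidable : ∀ {n} (P : Pred (Fin n) 0ℓ) → ¬ ¬ Decidable P
¬¬-decidable {zero}  P ¬dec = ¬dec λ ()
¬¬-decidable {suc n} P ¬dec = ¬¬-excluded-middle λ P₀? → ¬¬-decidable (P ∘ suc) λ P? →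
  ¬dec λ { zero → P₀? ; (suc x) → P? x }

IsLeast : Pred ℕ 0ℓ → ℕ → Set
IsLeast P j = P j × (∀ {i} → P i → j ≤ i)

least-witness : ∀ {P : Pred ℕ 0ℓ} → Decidable P → ∀ {b} → P b → ∃[ j ] IsLeast P j
least-witness P? {zero}  p = 0 , p , λ _ → z≤n
least-witness P? {suc b} p with P? 0
... | yes p₀ = 0 , p₀ , λ _ → z≤n
... | no ¬p₀ with least-witness (P? ∘ suc) p
...   | j , pj , least = suc j , pj , λ { {zero} q → ⊥-elim (¬p₀ q) ; {suc i} q → s≤s (least q) }

Star-exit : ∀ {A : Set} {_~_ : Rel A 0ℓ} {P : Pred A 0ℓ} → Decidable P → ∀ {a b} →
            Star _~_ a b → P a → ¬ P b → ∃₂ λ u w → Star _~_ a u × u ~ w × P u × ¬ P w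
Star-exit P? ε Pa ¬Pb = ⊥-elim (¬Pb Pa)
Star-exit P? (_◅_ {j = c} a~c c~*b) Pa ¬Pb with P? c
... | no ¬Pc = _ , c , ε , a~c , Pa , ¬Pc
... | yes Pc with Star-exit P? c~*b Pc ¬Pb
...   | u , w , c~*u , u~w , Pu , ¬Pw = u , w , a~c ◅ c~*u , u~w , Pu , ¬Pw

minV-≤ˡ : ∀ {n} (a b : Fin n) → minV a b Fin.≤ a
minV-≤ˡ a b with toℕ a ℕ.≤ᵇ toℕ b in test
... | true  = Finₚ.≤-refl
... | false = ℕₚ.<⇒≤ (ℕₚ.≰⇒> λ a≤b → subst T test (ℕₚ.≤⇒≤ᵇ a≤b))

minV-≤ʳ : ∀ {n} (a b : Fin n) → minV a b Fin.≤ b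
minV-≤ʳ a b with toℕ a ℕ.≤ᵇ toℕ b in test
... | true  = ℕₚ.≤ᵇ⇒≤ (toℕ a) (toℕ b) (subst T (sym test) _)
... | false = Finₚ.≤-refl

minV-cases : ∀ {n} (a b : Fin n) → minV a b ≡ a ⊎ minV a b ≡ b
minV-cases a b with toℕ a ℕ.≤ᵇ toℕ b
... | true  = inj₁ refl
... | false = inj₂ refl

minMV-≤ʳ : ∀ {n} (ma : Maybe (Fin n)) b → minMV ma b Fin.≤ b
minMV-≤ʳ nothing  b = Finₚ.≤-refl
minMV-≤ʳ (just a) b = minV-≤ʳ a b

module _ {n m} (m₁ m₂ : Fin m → Fin n) (v : Fin n) where

  private
    adjMin : List (Fin m) → Maybe (Fin n)
    adjMin = foldr (λ e acc → if does (m₁ e Finₚ.≟ v) then just (minMV acc (m₂ e)) else acc) nothing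

    adjMin-≤ : ∀ l {e} → e List.∈ l → m₁ e ≡ v → ∀ b → minMV (adjMin l) b Fin.≤ m₂ e
    adjMin-≤ (e ∷ l) (here refl) m₁e≡v b with m₁ e Finₚ.≟ v
    ... | yes _    = Finₚ.≤-trans (minV-≤ˡ _ b) (minMV-≤ʳ (adjMin l) (m₂ e))
    ... | no m₁e≢v = ⊥-elim (m₁e≢v m₁e≡v)
    adjMin-≤ (e′ ∷ l) (there e∈l) m₁e≡v b with m₁ e′ Finₚ.≟ v
    ... | yes _ = Finₚ.≤-trans (minV-≤ˡ _ b) (adjMin-≤ l e∈l m₁e≡v (m₂ e′))
    ... | no _  = adjMin-≤ l e∈l m₁e≡v b

    adjMin-nothing : (∀ e → m₁ e ≢ v) → ∀ l → adjMin l ≡ nothing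
    adjMin-nothing v∉im []      = refl
    adjMin-nothing v∉im (e ∷ l) with m₁ e Finₚ.≟ v
    ... | yes m₁e≡v = ⊥-elim (v∉im e m₁e≡v)
    ... | no _      = adjMin-nothing v∉im l

    adjMin-cases : ∀ l b → minMV (adjMin l) b ≡ b ⊎ ∃[ e ] (m₁ e ≡ v × minMV (adjMin l) b ≡ m₂ e)
    adjMin-cases []      b = inj₁ refl
    adjMin-cases (e ∷ l) b with m₁ e Finₚ.≟ v
    ... | no _ = adjMin-cases l b
    ... | yes m₁e≡v with minV-cases (minMV (adjMin l) (m₂ e)) b | adjMin-cases l (m₂ e)
    ...   | inj₂ ≡b     | _                          = inj₁ ≡b
    ...   | inj₁ ≡inner | inj₁ ≡m₂e                  = inj₂ (e , m₁e≡v , trans ≡inner ≡m₂e)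
    ...   | inj₁ ≡inner | inj₂ (e′ , m₁e′≡v , ≡m₂e′) = inj₂ (e′ , m₁e′≡v , trans ≡inner ≡m₂e′)

  minAdjMap-≤ : ∀ {e} → m₁ e ≡ v → ∀ b → minMV (minAdjMap m₁ m₂ v) b Fin.≤ m₂ e
  minAdjMap-≤ {e} = adjMin-≤ (allFin m) (∈-allFin e)

  minAdjMap-nothing : (∀ e → m₁ e ≢ v) → minAdjMap m₁ m₂ v ≡ nothing
  minAdjMap-nothing v∉im = adjMin-nothing v∉im (allFin m)

  minAdjMap-cases : ∀ b → minMV (minAdjMap m₁ m₂ v) b ≡ b
                        ⊎ ∃[ e ] (m₁ e ≡ v × minMV (minAdjMap m₁ m₂ v) b ≡ m₂ e)
  minAdjMap-cases = adjMin-cases (allFin m)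

Deflationary : ∀ {n} → (Fin n → Fin n) → Set
Deflationary f = ∀ x → f x Fin.≤ x

module _ {n} (f : Fin n → Fin n) where

  iter-≤ : Deflationary f → ∀ j → Deflationary (iter j f)
  iter-≤ f≤ zero    x = Finₚ.≤-refl
  iter-≤ f≤ (suc j) x = Finₚ.≤-trans (f≤ _) (iter-≤ f≤ j x)

  iter-fixed : ∀ {y} → f y ≡ y → ∀ j → iter j f y ≡ y
  iter-fixed fy≡y zero    = refl
  iter-fixed fy≡y (suc j) = trans (cong f (iter-fixed fy≡y j)) fy≡y

  iter-commutes : ∀ j x → iter j f (f x) ≡ f (iter j f x)
  iter-commutes zero    x = refl
  iter-commutes (suc j) x = cong f (iter-commutes j x)

  iter-star : ∀ {_~_ : Rel (Fin n) 0ℓ} → (∀ x → Star _~_ x (f x)) → ∀ j x → Star _~_ x (iter j f x)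
  iter-star x~*fx zero    x = ε
  iter-star x~*fx (suc j) x = iter-star x~*fx j x ◅◅ x~*fx _

  iter-stalls-or-descends : Deflationary f → ∀ j x →
                            f (iter j f x) ≡ iter j f x ⊎ toℕ (iter j f x) + j ≤ toℕ x
  iter-stalls-or-descends f≤ zero    x = inj₂ (ℕₚ.≤-reflexive (ℕₚ.+-identityʳ _))
  iter-stalls-or-descends f≤ (suc j) x with iter-stalls-or-descends f≤ j x
  ... | inj₁ stalled = inj₁ (cong f stalled)
  ... | inj₂ descended with f (iter j f x) Finₚ.≟ iter j f x
  ...   | yes stalled = inj₁ (cong f stalled)
  ...   | no moved    = inj₂ (ℕₚ.≤-trans (ℕₚ.≤-reflexive (ℕₚ.+-suc _ j))
                          (ℕₚ.≤-trans (ℕₚ.+-monoˡ-≤ j (Finₚ.≤∧≢⇒< (f≤ _) moved)) descended))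

  -- A point that keeps moving descends in every step, which cannot happen n times in Fin n.
  closure-fixed : Deflationary f → ∀ x → f (closure f x) ≡ closure f x
  closure-fixed f≤ x with iter-stalls-or-descends f≤ n x
  ... | inj₁ stalled    = stalled
  ... | inj₂ descended  = ⊥-elim (ℕₚ.<-irrefl refl
          (ℕₚ.≤-<-trans (ℕₚ.≤-trans (ℕₚ.m≤n+m n _) descended) (Finₚ.toℕ<n x)))

  closure-absorbs : Deflationary f → ∀ x → closure f (f x) ≡ closure f x
  closure-absorbs f≤ x = trans (iter-commutes n x) (closure-fixed f≤ x)

+-double-suc : ∀ b j → b + (suc j + suc j) ≡ 2 + (b + (j + j))
+-double-suc = solve-∀

double-* : ∀ p x → 2 * p * x ≡ p * (x + x)
double-* = solve-∀

module _ {n m} (E₁ E₂ : Fin m → Fin n) where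

  private
    Adj  = Adjacent E₁ E₂
    Conn = Connected E₁ E₂

  adjacent-sym : ∀ {u w} → Adj u w → Adj w u
  adjacent-sym (e , inj₁ ends) = e , inj₂ ends
  adjacent-sym (e , inj₂ ends) = e , inj₁ ends

  connected-sym : ∀ {u w} → Conn u w → Conn w u
  connected-sym = reverse adjacent-sym

  module _ (R : Fin n → Fin n) where

    private
      fromLeft fromRight : Fin n → Maybe (Fin n)
      fromLeft  = minAdjMap (R ∘ E₁) (R ∘ E₂)
      fromRight = minAdjMap (R ∘ E₂) (R ∘ E₁)

    step-≤ : ∀ v → stepMap E₁ E₂ R v Fin.≤ R v
    step-≤ v = Finₚ.≤-trans (minMV-≤ʳ (fromRight v) _) (minMV-≤ʳ (fromLeft v) (R v))

    step-≤-adjacent : ∀ {u w} → Adj u w → stepMap E₁ E₂ R (R u) Fin.≤ R w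
    step-≤-adjacent (e , inj₁ (refl , refl)) =
      Finₚ.≤-trans (minMV-≤ʳ (fromRight _) _) (minAdjMap-≤ (R ∘ E₁) (R ∘ E₂) (R (E₁ e)) refl _)
    step-≤-adjacent (e , inj₂ (refl , refl)) = minAdjMap-≤ (R ∘ E₂) (R ∘ E₁) (R (E₂ e)) refl _

    step-unmoved : ∀ {v} → (∀ x → R x ≢ v) → stepMap E₁ E₂ R v ≡ R v
    step-unmoved {v} v∉im = cong₂ (λ right left → minMV right (minMV left (R v)))
      (minAdjMap-nothing (R ∘ E₂) (R ∘ E₁) v (v∉im ∘ E₂))
      (minAdjMap-nothing (R ∘ E₁) (R ∘ E₂) v (v∉im ∘ E₁))

    module _ (x~*Rx : ∀ x → Conn x (R x)) where

      adjacent-classes-connected : ∀ {a b} → Adj a b → Conn (R a) (R b)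
      adjacent-classes-connected {a} {b} a~b = connected-sym (x~*Rx a) ◅◅ a~b ◅ x~*Rx b

      step-connected : ∀ v → Conn v (stepMap E₁ E₂ R v)
      step-connected v with minAdjMap-cases (R ∘ E₂) (R ∘ E₁) v (minMV (fromLeft v) (R v))
      ... | inj₂ (e , R₂≡v , ≡R₁) =
        subst₂ Conn R₂≡v (sym ≡R₁) (adjacent-classes-connected (e , inj₂ (refl , refl)))
      ... | inj₁ ≡left with minAdjMap-cases (R ∘ E₁) (R ∘ E₂) v (R v)
      ...   | inj₁ ≡Rv               = subst (Conn v) (sym (trans ≡left ≡Rv)) (x~*Rx v)
      ...   | inj₂ (e , R₁≡v , ≡R₂) =
        subst₂ Conn R₁≡v (sym (trans ≡left ≡R₂)) (adjacent-classes-connected (e , inj₁ (refl , refl)))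

  private
    R : ℕ → Fin n → Fin n
    R = Rmap E₁ E₂

    step : ℕ → Fin n → Fin n
    step k = stepMap E₁ E₂ (R k)

  Rmap-deflationary : ∀ k → Deflationary (R k)
  step-deflationary : ∀ k → Deflationary (step k)
  step-deflationary k x = Finₚ.≤-trans (step-≤ (R k) x) (Rmap-deflationary k x)
  Rmap-deflationary zero    x = Finₚ.≤-refl
  Rmap-deflationary (suc k) x = iter-≤ (step k) (step-deflationary k) n x

  Rmap-idempotent : ∀ k x → R k (R k x) ≡ R k x
  Rmap-idempotent zero    x = refl
  Rmap-idempotent (suc k) x = iter-fixed (step k) (closure-fixed (step k) (step-deflationary k) x) n

  Rmap-connected : ∀ k x → Conn x (R k x)
  Rmap-connected zero    x = ε
  Rmap-connected (suc k) x = iter-star (step k) (step-connected (R k) (Rmap-connected k)) n x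

  Rmap-suc-≤-step : ∀ k x → R (suc k) x Fin.≤ step k x
  Rmap-suc-≤-step k x =
    Finₚ.≤-trans (Finₚ.≤-reflexive (sym (closure-absorbs (step k) (step-deflationary k) x)))
                 (iter-≤ (step k) (step-deflationary k) n (step k x))

  Rmap-suc-absorbs : ∀ k x → R (suc k) (R k x) ≡ R (suc k) x
  Rmap-suc-absorbs k x with R k x Finₚ.≟ x
  ... | yes Rx≡x = cong (R (suc k)) Rx≡x
  ... | no  Rx≢x = begin
    R (suc k) (R k x)     ≡⟨ cong (R (suc k)) (step-unmoved (R k) x∉im) ⟨
    R (suc k) (step k x)  ≡⟨ closure-absorbs (step k) (step-deflationary k) x ⟩
    R (suc k) x           ∎
    where
    open ≡-Reasoning
    x∉im : ∀ y → R k y ≢ x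
    x∉im y Ry≡x = Rx≢x (trans (cong (R k) (sym Ry≡x)) (trans (Rmap-idempotent k y) Ry≡x))

  Rmap-2+-absorbs : ∀ k x → R (2 + k) (R k x) ≡ R (2 + k) x
  Rmap-2+-absorbs k x = begin
    R (2 + k) (R k x)               ≡⟨ Rmap-suc-absorbs (suc k) (R k x) ⟨
    R (2 + k) (R (suc k) (R k x))   ≡⟨ cong (R (2 + k)) (Rmap-suc-absorbs k x) ⟩
    R (2 + k) (R (suc k) x)         ≡⟨ Rmap-suc-absorbs (suc k) x ⟩
    R (2 + k) x                     ∎
    where open ≡-Reasoning

  Rmap-fixed-pred : ∀ k {r} → R (suc k) r ≡ r → R k r ≡ r
  Rmap-fixed-pred k {r} fixed = Finₚ.≤-antisym (Rmap-deflationary k r)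
    (Finₚ.≤-trans (Finₚ.≤-reflexive (sym fixed))
                  (Finₚ.≤-trans (Rmap-suc-≤-step k r) (step-≤ (R k) r)))

  Rmap-suc-≤-adjacent : ∀ k {u w} → Adj u w → R (suc k) u Fin.≤ R k w
  Rmap-suc-≤-adjacent k {u} u~w = Finₚ.≤-trans (Finₚ.≤-reflexive (sym (Rmap-suc-absorbs k u)))
    (Finₚ.≤-trans (Rmap-suc-≤-step k (R k u)) (step-≤-adjacent (R k) u~w))

  Rmap-suc-moves : ∀ k {u w} → Adj u w → R k w Fin.< R k u → R (suc k) (R k u) ≢ R k u
  Rmap-suc-moves k {u} u~w Rw<Ru fixed = ℕₚ.<-irrefl refl (ℕₚ.≤-<-trans
    (Finₚ.≤-trans (Finₚ.≤-reflexive (trans (sym fixed) (Rmap-suc-absorbs k u)))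
                  (Rmap-suc-≤-adjacent k u~w))
    Rw<Ru)

  Rmap-2+-merges : ∀ k {u w r} → Adj u w → R k u ≡ r → R (2 + k) r ≡ r → R (2 + k) w ≡ r
  Rmap-2+-merges k {u} {w} {r} u~w Ru≡r fixed = begin
    R (2 + k) w                ≡⟨ Rmap-suc-absorbs (suc k) w ⟨
    R (2 + k) (R (suc k) w)    ≡⟨ cong (R (2 + k)) (Finₚ.≤-antisym Rw≤r r≤Rw) ⟩
    R (2 + k) r                ≡⟨ fixed ⟩
    r                          ∎
    where
    open ≡-Reasoning
    Rw≤r : R (suc k) w Fin.≤ r
    Rw≤r = Finₚ.≤-trans (Rmap-suc-≤-adjacent k (adjacent-sym u~w)) (Finₚ.≤-reflexive Ru≡r)
    R₂u≡r : R (2 + k) u ≡ r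
    R₂u≡r = trans (sym (Rmap-2+-absorbs k u)) (trans (cong (R (2 + k)) Ru≡r) fixed)
    r≤Rw : r Fin.≤ R (suc k) w
    r≤Rw = Finₚ.≤-trans (Finₚ.≤-reflexive (sym R₂u≡r)) (Rmap-suc-≤-adjacent (suc k) u~w)

  IsRep : ℕ → Pred (Fin n) 0ℓ
  IsRep k x = R k x ≡ x

  Rep : Fin n → ℕ → Pred (Fin n) 0ℓ
  Rep v k = Conn v ∩ IsRep k

  Unresolved : Fin n → ℕ → Set
  Unresolved v k = ∃₂ λ a b → a ≢ b × Rep v k a × Rep v k b

  unresolved-pred : ∀ {v} k → Unresolved v (suc k) → Unresolved v k
  unresolved-pred k (a , b , a≢b , (va , ra) , (vb , rb)) =
    a , b , a≢b , (va , Rmap-fixed-pred k ra) , (vb , Rmap-fixed-pred k rb)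

  unresolved-zero : ∀ {v} k → Unresolved v k → Unresolved v 0
  unresolved-zero zero    unresolved = unresolved
  unresolved-zero (suc k) unresolved = unresolved-zero k (unresolved-pred k unresolved)

  another-rep : ∀ {v} k → Unresolved v k → ∀ r → ∃[ s ] (Rep v k s × s ≢ r)
  another-rep k (a , b , a≢b , a∈ , b∈) r with a Finₚ.≟ r
  ... | yes a≡r = b , b∈ , λ b≡r → a≢b (trans a≡r (sym b≡r))
  ... | no  a≢r = a , a∈ , a≢r

  class-exit : ∀ {v} k {r} → Unresolved v k → Rep v k r →
               ∃₂ λ u w → Adj u w × R k u ≡ r × R k w ≢ r × Conn v u
  class-exit {v} k {r} unresolved (vr , rr) with another-rep k unresolved r
  ... | s , (vs , rs) , s≢r
      with Star-exit (λ x → R k x Finₚ.≟ r) (connected-sym vr ◅◅ vs) rr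
                     (λ Rs≡r → s≢r (trans (sym rs) Rs≡r))
  ...   | u , w , r~*u , u~w , Ru≡r , Rw≢r = u , w , u~w , Ru≡r , Rw≢r , vr ◅◅ r~*u

  component-map : ∀ k → (∀ v → ¬ Unresolved v k) → IsComponentMap E₁ E₂ (R k)
  component-map k resolved v = Rmap-connected k v , minimal
    where
    minimal : ∀ w → Conn v w → R k v Fin.≤ w
    minimal w v~*w with R k v Finₚ.≤? w
    ... | yes Rv≤w = Rv≤w
    ... | no  Rv≰w = ⊥-elim (resolved v (R k v , R k w , Rv≢Rw ,
                                         (Rmap-connected k v , Rmap-idempotent k v) ,
                                         (v~*w ◅◅ Rmap-connected k w , Rmap-idempotent k w)))
      where
      Rv≢Rw : R k v ≢ R k w
      Rv≢Rw Rv≡Rw = Rv≰w (Finₚ.≤-trans (Finₚ.≤-reflexive Rv≡Rw) (Rmap-deflationary k w))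

  adjacent? : ∀ u w → Dec (Adj u w)
  adjacent? u w = Finₚ.any? λ e → (E₁ e Finₚ.≟ u ×-dec E₂ e Finₚ.≟ w)
                             ⊎-dec (E₁ e Finₚ.≟ w ×-dec E₂ e Finₚ.≟ u)

  module Component {v} (C? : Decidable (Conn v)) where

    Within : ℕ → Pred (Fin n) 0ℓ
    Within zero    x = x ≡ v
    Within (suc j) x = Within j x ⊎ ∃[ y ] (Within j y × Adj y x)

    within? : ∀ j → Decidable (Within j)
    within? zero    x = x Finₚ.≟ v
    within? (suc j) x = within? j x ⊎-dec Finₚ.any? λ y → within? j y ×-dec adjacent? y x

    within⇒connected : ∀ {j x} → Within j x → Conn v x
    within⇒connected {zero}  refl                  = ε
    within⇒connected {suc j} (inj₁ x∈)             = within⇒connected x∈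
    within⇒connected {suc j} (inj₂ (y , y∈ , y~x)) = within⇒connected y∈ ◅◅ y~x ◅ ε

    star⇒within : ∀ {j x y} → Within j x → Star Adj x y → ∃[ i ] Within i y
    star⇒within x∈ ε             = _ , x∈
    star⇒within x∈ (x~z ◅ z~*y) = star⇒within (inj₂ (_ , x∈ , x~z)) z~*y

    dist : Fin n → ℕ
    dist x with C? x
    ... | yes v~*x = proj₁ (least-witness (λ j → within? j x) (proj₂ (star⇒within {0} refl v~*x)))
    ... | no  _    = 0

    dist-least : ∀ {x} → Conn v x → IsLeast (λ j → Within j x) (dist x)
    dist-least {x} v~*x with C? x
    ... | yes v~*x′ = proj₂ (least-witness (λ j → within? j x) (proj₂ (star⇒within {0} refl v~*x′)))
    ... | no  ¬v~*x = ⊥-elim (¬v~*x v~*x)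

    closer-neighbour : ∀ {x} → Conn v x → x ≢ v → ∃[ y ] (Conn v y × Adj y x × dist y < dist x)
    closer-neighbour {x} v~*x x≢v = descend (dist x) (dist-least v~*x)
      where
      descend : ∀ j → IsLeast (λ i → Within i x) j → ∃[ y ] (Conn v y × Adj y x × dist y < j)
      descend zero    (x≡v , _)                    = ⊥-elim (x≢v x≡v)
      descend (suc j) (inj₁ x∈ , least)            = ⊥-elim (ℕₚ.n≮n j (least x∈))
      descend (suc j) (inj₂ (y , y∈ , y~x) , _)    =
        y , within⇒connected y∈ , y~x , s≤s (proj₂ (dist-least (within⇒connected y∈)) y∈)

    farther : Fin m → Fin n
    farther e = if does (dist (E₁ e) ℕ.<? dist (E₂ e)) then E₂ e else E₁ e

    farther-≡ : ∀ e {x y} → (E₁ e ≡ y × E₂ e ≡ x) ⊎ (E₁ e ≡ x × E₂ e ≡ y) →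
                dist y < dist x → farther e ≡ x
    farther-≡ e (inj₁ (refl , refl)) closer =
      cong (if_then E₂ e else E₁ e) (dec-true (dist (E₁ e) ℕ.<? dist (E₂ e)) closer)
    farther-≡ e (inj₂ (refl , refl)) closer =
      cong (if_then E₂ e else E₁ e) (dec-false (dist (E₁ e) ℕ.<? dist (E₂ e)) (ℕₚ.<-asym closer))

    farther-onto : ∀ {x} → (Conn v ∩ ∁ (_≡ v)) x → ∃[ e ] (Conn v (E₁ e) × farther e ≡ x)
    farther-onto (v~*x , x≢v) with closer-neighbour v~*x x≢v
    ... | y , v~*y , (e , ends) , closer = e , tail-connected ends , farther-≡ e ends closer
      where
      tail-connected : (E₁ e ≡ y × E₂ e ≡ _) ⊎ (E₁ e ≡ _ × E₂ e ≡ y) → Conn v (E₁ e)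
      tail-connected (inj₁ (refl , _)) = v~*y
      tail-connected (inj₂ (refl , _)) = v~*x

    component-vertices≤1+edges : count C? ≤ suc (count (C? ∘ E₁))
    component-vertices≤1+edges = ℕₚ.≤-trans (count-remove C? v)
      (s≤s (count-surjection (C? ∩? ∁? (Finₚ._≟ v)) (C? ∘ E₁) farther farther-onto))

    isRep? : ∀ k → Decidable (IsRep k)
    isRep? k x = R k x Finₚ.≟ x

    rep? : ∀ k → Decidable (Rep v k)
    rep? k = C? ∩? isRep? k

    #reps : ℕ → ℕ
    #reps k = count (rep? k)

    #reps-≥2 : ∀ k → Unresolved v k → 2 ≤ #reps k
    #reps-≥2 k = count-≥2 (rep? k)

    #reps-decreasing : ∀ k → Unresolved v k → #reps (suc k) < #reps k
    #reps-decreasing k unresolved@(_ , _ , _ , a∈ , _) with class-exit k unresolved a∈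
    ... | u , w , u~w , refl , Rw≢Ru , v~*u = begin
      suc (#reps (suc k))
        ≡⟨ ℕₚ.+-comm 1 _ ⟩
      #reps (suc k) + 1
        ≤⟨ ℕₚ.+-mono-≤ survivors (count-≥1 (rep? k ∩? ∁? (isRep? (suc k))) (proj₂ moved)) ⟩
      count (rep? k ∩? isRep? (suc k)) + count (rep? k ∩? ∁? (isRep? (suc k)))
        ≡⟨ count-partition (rep? k) (isRep? (suc k)) ⟨
      #reps k ∎
      where
      open ℕₚ.≤-Reasoning
      survivors : #reps (suc k) ≤ count (rep? k ∩? isRep? (suc k))
      survivors = count-mono (rep? (suc k)) (rep? k ∩? isRep? (suc k))
                             λ (c , r) → (c , Rmap-fixed-pred k r) , r
      moved-rep : ∀ {a b} → Adj a b → Conn v a → R k b Fin.< R k a →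
                  (Rep v k ∩ ∁ (IsRep (suc k))) (R k a)
      moved-rep {a} a~b v~*a Rb<Ra =
        (v~*a ◅◅ Rmap-connected k a , Rmap-idempotent k a) , Rmap-suc-moves k a~b Rb<Ra
      moved : ∃[ x ] (Rep v k ∩ ∁ (IsRep (suc k))) x
      moved with Finₚ.<-cmp (R k w) (R k u)
      ... | tri< Rw<Ru _ _ = R k u , moved-rep u~w v~*u Rw<Ru
      ... | tri≈ _ Rw≡Ru _ = ⊥-elim (Rw≢Ru Rw≡Ru)
      ... | tri> _ _ Ru<Rw = R k w , moved-rep (adjacent-sym u~w) (v~*u ◅◅ u~w ◅ ε) Ru<Rw

    #reps-halving : ∀ k → Unresolved v k → #reps (2 + k) + #reps (2 + k) ≤ #reps k
    #reps-halving k unresolved = begin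
      #reps (2 + k) + #reps (2 + k)
        ≤⟨ ℕₚ.+-mono-≤ survivors merged ⟩
      count (rep? k ∩? isRep? (2 + k)) + count (rep? k ∩? ∁? (isRep? (2 + k)))
        ≡⟨ count-partition (rep? k) (isRep? (2 + k)) ⟨
      #reps k ∎
      where
      open ℕₚ.≤-Reasoning
      fixed-pred₂ : ∀ {r} → IsRep (2 + k) r → IsRep k r
      fixed-pred₂ = Rmap-fixed-pred k ∘ Rmap-fixed-pred (suc k)
      survivors : #reps (2 + k) ≤ count (rep? k ∩? isRep? (2 + k))
      survivors = count-mono (rep? (2 + k)) (rep? k ∩? isRep? (2 + k)) λ (c , r) → (c , fixed-pred₂ r) , r
      absorbed : ∀ {r} → Rep v (2 + k) r →
                 ∃[ y ] ((Rep v k ∩ ∁ (IsRep (2 + k))) y × R (2 + k) y ≡ r)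
      absorbed {r} (v~*r , fixed) with class-exit k unresolved (v~*r , fixed-pred₂ fixed)
      ... | u , w , u~w , Ru≡r , Rw≢r , v~*u =
        R k w ,
        ((v~*u ◅◅ u~w ◅ Rmap-connected k w , Rmap-idempotent k w) ,
         λ fixed′ → Rw≢r (trans (sym fixed′) R₂Rw≡r)) ,
        R₂Rw≡r
        where
        R₂Rw≡r : R (2 + k) (R k w) ≡ r
        R₂Rw≡r = trans (Rmap-2+-absorbs k w) (Rmap-2+-merges k u~w Ru≡r fixed)
      merged : #reps (2 + k) ≤ count (rep? k ∩? ∁? (isRep? (2 + k)))
      merged = count-surjection (rep? (2 + k)) (rep? k ∩? ∁? (isRep? (2 + k))) (R (2 + k)) absorbed

    #reps-iterated : ∀ j b → Unresolved v (b + (j + j)) → 2 ^ j * #reps (b + (j + j)) ≤ #reps b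
    #reps-iterated zero b _ =
      ℕₚ.≤-reflexive (trans (ℕₚ.*-identityˡ _) (cong #reps (ℕₚ.+-identityʳ b)))
    #reps-iterated (suc j) b unresolved rewrite +-double-suc b j = begin
      2 ^ suc j * #reps (2 + k)               ≡⟨ double-* (2 ^ j) (#reps (2 + k)) ⟩
      2 ^ j * (#reps (2 + k) + #reps (2 + k)) ≤⟨ ℕₚ.*-monoʳ-≤ (2 ^ j) (#reps-halving k unresolvedₖ) ⟩
      2 ^ j * #reps k                         ≤⟨ #reps-iterated j b unresolvedₖ ⟩
      #reps b                                 ∎
      where
      open ℕₚ.≤-Reasoning
      k = b + (j + j)
      unresolvedₖ = unresolved-pred k (unresolved-pred (suc k) unresolved)

    #reps-unresolved : ∀ j b → Unresolved v (b + (j + j)) → 2 ^ suc j ≤ #reps b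
    #reps-unresolved j b unresolved = begin
      2 ^ suc j                      ≡⟨ ℕₚ.*-comm 2 (2 ^ j) ⟩
      2 ^ j * 2                      ≤⟨ ℕₚ.*-monoʳ-≤ (2 ^ j) (#reps-≥2 (b + (j + j)) unresolved) ⟩
      2 ^ j * #reps (b + (j + j))    ≤⟨ #reps-iterated j b unresolved ⟩
      #reps b                        ∎
      where open ℕₚ.≤-Reasoning

    #reps₀≤1+N : ∀ {N} → LargestComponentEdges E₁ E₂ N → #reps 0 ≤ suc N
    #reps₀≤1+N {N} largest = begin
      #reps 0                                 ≤⟨ count-mono (rep? 0) C? proj₁ ⟩
      count C?                                ≤⟨ component-vertices≤1+edges ⟩
      suc (count (C? ∘ E₁))                   ≡⟨ cong suc (∣tabulate∣≡count (C? ∘ E₁)) ⟨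
      suc ∣ tabulate (does ∘ C? ∘ E₁) ∣       ≤⟨ s≤s (proj₁ largest v _ (∈-tabulate⇔ (C? ∘ E₁))) ⟩
      suc N                                   ∎
      where open ℕₚ.≤-Reasoning

  module _ {N} (largest : LargestComponentEdges E₁ E₂ N) where

    -- The conclusions are negations, so connectivity to v may be assumed decidable.
    resolved-even : ∀ a → ¬ 2 ^ suc a ≤ suc N → ∀ v → ¬ Unresolved v (a + a)
    resolved-even a too-big v unresolved = ¬¬-decidable (Conn v) λ C? →
      too-big (ℕₚ.≤-trans (Component.#reps-unresolved C? a 0 unresolved)
                          (Component.#reps₀≤1+N C? largest))

    resolved-odd : ∀ a → N < 2 ^ suc a → ∀ v → ¬ Unresolved v (suc (a + a))
    resolved-odd a small v unresolved = ¬¬-decidable (Conn v) λ C? → let open Component C? in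
      ℕₚ.<⇒≱ small (ℕₚ.≤-pred (begin
        suc (2 ^ suc a)   ≤⟨ s≤s (#reps-unresolved a 1 unresolved) ⟩
        suc (#reps 1)     ≤⟨ #reps-decreasing 0 (unresolved-zero (suc (a + a)) unresolved) ⟩
        #reps 0           ≤⟨ #reps₀≤1+N largest ⟩
        suc N             ∎))
      where open ℕₚ.≤-Reasoning

binary-magnitude : ∀ {N} → 1 ≤ N → ∃[ a ] (2 ^ a ≤ N × N < 2 ^ suc a)
binary-magnitude {suc zero}    _ = 0 , s≤s z≤n , s≤s (s≤s z≤n)
binary-magnitude {suc (suc M)} _ with binary-magnitude {suc M} (s≤s z≤n)
... | a , lower , upper with ℕₚ.m≤n⇒m<n∨m≡n upper
...   | inj₁ upper′    = a , ℕₚ.m≤n⇒m≤1+n lower , upper′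
...   | inj₂ 2+M≡2^1+a = suc a , ℕₚ.≤-reflexive (sym 2+M≡2^1+a) ,
                         subst (_< 2 ^ suc (suc a)) (sym 2+M≡2^1+a)
                               (ℕₚ.^-monoʳ-< 2 (s≤s (s≤s z≤n)) (ℕₚ.n<1+n (suc a)))

even-exponent-bound : ∀ a {N} → 2 ^ a ≤ N → 2 ^ (a + a) ≤ N * N
even-exponent-bound a 2^a≤N = subst (_≤ _) (sym (ℕₚ.^-distribˡ-+-* 2 a a)) (ℕₚ.*-mono-≤ 2^a≤N 2^a≤N)

suc-square-≤ : ∀ {N} → 3 ≤ N → suc N * suc N ≤ 2 * (N * N)
suc-square-≤ (s≤s (s≤s (s≤s {n = M} z≤n))) =
  subst ((4 + M) * (4 + M) ≤_) (identity M) (ℕₚ.m≤m+n _ (2 + 4 * M + M * M))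
  where
  identity : ∀ M → (4 + M) * (4 + M) + (2 + 4 * M + M * M) ≡ 2 * ((3 + M) * (3 + M))
  identity = solve-∀

odd-exponent-bound : ∀ a {N} → 2 ≤ N → 2 ^ suc a ≤ suc N → N < 2 ^ suc a → 2 ^ suc (a + a) ≤ N * N
odd-exponent-bound zero    2≤N _ N<2 = ⊥-elim (ℕₚ.<⇒≱ N<2 2≤N)
odd-exponent-bound (suc a) {N} 2≤N 2^2+a≤1+N _ = ℕₚ.*-cancelˡ-≤ 2 (begin
  2 * 2 ^ suc (suc a + suc a)     ≡⟨ cong (λ i → 2 ^ suc (suc i)) (ℕₚ.+-suc a (suc a)) ⟨
  2 ^ (suc (suc a) + suc (suc a)) ≡⟨ ℕₚ.^-distribˡ-+-* 2 (suc (suc a)) (suc (suc a)) ⟩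
  2 ^ suc (suc a) * 2 ^ suc (suc a) ≤⟨ ℕₚ.*-mono-≤ 2^2+a≤1+N 2^2+a≤1+N ⟩
  suc N * suc N                   ≤⟨ suc-square-≤ 3≤N ⟩
  2 * (N * N)                     ∎)
  where
  open ℕₚ.≤-Reasoning
  3≤N : 3 ≤ N
  3≤N = ℕₚ.≤-pred (ℕₚ.≤-trans (ℕₚ.*-monoʳ-≤ 2 (ℕₚ.*-monoʳ-≤ 2 (ℕₚ.m^n>0 2 a))) 2^2+a≤1+N)

lemma1 : ∀ {n m} (E₁ E₂ : Fin m → Fin n) (N : ℕ) →
    LargestComponentEdges E₁ E₂ N → 2 ≤ N →
    ∃[ k ] (2 ^ k ≤ N * N × IsComponentMap E₁ E₂ (Rmap E₁ E₂ k))
lemma1 E₁ E₂ N largest 2≤N with binary-magnitude (ℕₚ.≤-trans (s≤s z≤n) 2≤N)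
... | a , lower , upper with 2 ^ suc a ℕₚ.≤? suc N
...   | yes fits    = suc (a + a) , odd-exponent-bound a 2≤N fits upper ,
                      component-map E₁ E₂ (suc (a + a)) (resolved-odd E₁ E₂ largest a upper)
...   | no  too-big = a + a , even-exponent-bound a lower ,
                      component-map E₁ E₂ (a + a) (resolved-even E₁ E₂ largest a too-big)
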